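{- 1. For $l=1,2,\dots$: $(1-t)f_{A_l}(t)=f^+_{A_{l+1}}(t)$. 2. For $l=2,3,\dots$: $f_{B_l}(t)+f_{B_{l-1}}(t)=2f^+_{B_l}(t)$. 3. For $l=4,5,\dots$: $f_{D_l}(t)=\frac{l-2}{2(l-1)}f_{B_l}(t)+\frac{l}{2(l-1)}(1-2t)f_{B_{l-1}}(t)$.
   Context: For a root system type $P$, $f_P(t)=\sum_i c_i(-t)^i$ and $f^+_P(t)=\sum_i c^+_i(-t)^i$, where $c_i$ (resp. $c_i^+$) is the number of $i$-vertex faces of the Fomin–Zelevinsky cluster complex $\Delta(P)$ on the almost positive roots (resp. of its positive part $\Delta_+(P)$, the induced subcomplex on the positive roots). Known explicit forms: $f_{A_l}(t)=\sum_{k=0}^l(-1)^k\frac{1}{l+2}\binom{l}{k}\binom{l+k+2}{k+1}t^k$, $f^+_{A_n}(t)=\sum_{k=0}^n(-1)^k\frac1n\binom nk\binom{n+k}{k+1}t^k$, $f_{B_l}(t)=\sum_{k=0}^l(-1)^k\binom lk\binom{l+k}{k}t^k$ (for all $l\ge1$), $f^+_{B_l}(t)=\sum_{k=0}^l(-1)^k\binom lk\binom{l+k-1}{k}t^k$, $f_{D_l}(t)=\sum_{k=0}^l(-1)^k\big(\binom lk\binom{l+k-1}{k}+\binom{l-2}{k-2}\binom{l+k-2}{k}\big)t^k$ with $\binom nm=0$ for $m<0$. -}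

module Defs where

open import Data.Nat using (ℕ; zero; suc; _+_; _*_; _∸_)
open import Data.Nat.Combinatorics using (_C_)
open import Data.Integer using (+_)
open import Data.Rational using (ℚ; _/_; 0ℚ; 1ℚ; -_) renaming (_+_ to _+ℚ_; _*_ to _*ℚ_; _-_ to _-ℚ_)

-- Polynomials in t with rational coefficients, represented by their
-- coefficient sequence: p k is the coefficient of t^k.
Poly : Set
Poly = ℕ → ℚ

nat : ℕ → ℚ
nat n = + n / 1

-- the rational a/d (only ever used with d ≠ 0; value 0 for d = 0)
frac : ℕ → ℕ → ℚ
frac a zero    = 0ℚ
frac a (suc d) = + a / suc d

sgn : ℕ → ℚ
sgn zero    = 1ℚ
sgn (suc k) = - sgn k

_⊕_ : Poly → Poly → Poly
(p ⊕ q) k = p k +ℚ q k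

_⊙_ : ℚ → Poly → Poly
(c ⊙ p) k = c *ℚ p k

mulLin : ℚ → ℚ → Poly → Poly
mulLin a b p zero    = a *ℚ p zero
mulLin a b p (suc k) = a *ℚ p (suc k) +ℚ b *ℚ p k

_≈ₚ_ : Poly → Poly → Set
p ≈ₚ q = ∀ k → p k ≡ q k
  where open import Relation.Binary.PropositionalEquality using (_≡_)

-- The f-polynomials, given by the known explicit forms from the context.
-- f_{A_l}(t) = Σ_k (-1)^k 1/(l+2) C(l,k) C(l+k+2,k+1) t^k
fA : ℕ → Poly
fA l k = sgn k *ℚ (frac 1 (l + 2) *ℚ nat ((l C k) * ((l + k + 2) C (k + 1))))

fA⁺ : ℕ → Poly
fA⁺ n k = sgn k *ℚ (frac 1 n *ℚ nat ((n C k) * ((n + k) C (k + 1))))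

fB : ℕ → Poly
fB l k = sgn k *ℚ nat ((l C k) * ((l + k) C k))

fB⁺ : ℕ → Poly
fB⁺ l k = sgn k *ℚ nat ((l C k) * ((l + k ∸ 1) C k))

-- C(l-2,k-2) C(l+k-2,k), with C(n,m) = 0 for m < 0  (used for l ≥ 4)
dExtra : ℕ → ℕ → ℕ
dExtra l zero          = 0
dExtra l (suc zero)    = 0
dExtra l (suc (suc j)) = ((l ∸ 2) C j) * ((l + suc (suc j) ∸ 2) C (suc (suc j)))

fD : ℕ → Poly
fD l k = sgn k *ℚ nat ((l C k) * ((l + k ∸ 1) C k) + dExtra l k)

-- Coefficientwise, each identity relates products of two binomial coefficients.
-- All of them follow from Pascal's rule and the two absorption identities
-- (k+1) C(n+1,k+1) = (n+1) C(n,k) and (k+1) C(n+k,k+1) = n C(n+k,k); the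
-- D-identity reduces, via the B-identity for l - 1, to
-- c⁺_{B_l,k} + (l-1) c_{k-2} = c_{B_{l-1},k} + l c_{B_{l-1},k-1}, where c_{k-2} is the
-- extra term C(l-2,k-2) C(l+k-2,k) of c_{D_l,k}. The rational factors 1/(l+2), 1/(l+1)
-- and 1/(2(l-1)) are cleared once, so all the combinatorics happens in ℕ.

module Submission where

open import Defs
open import Data.Nat using (ℕ; zero; suc; NonZero; _+_; _*_; _∸_; _≤_; z≤n; s≤s)
open import Data.Nat.Properties using (+-comm; +-suc; *-assoc; *-zeroʳ; *-identityˡ; *-identityʳ;
  *-distribˡ-+; *-distribʳ-+; +-identityʳ; +-assoc; +-cancelˡ-≡; *-cancelˡ-≡;
  *-commutativeSemigroup)
open import Algebra.Properties.CommutativeSemigroup *-commutativeSemigroup using (x∙yz≈y∙xz)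
open import Data.Nat.Combinatorics using (_C_; nCk+nC[k+1]≡[n+1]C[k+1]; nC1≡n; k>n⇒nCk≡0)
open import Data.Nat.Tactic.RingSolver using (solve-∀)
import Data.Integer as ℤ
import Data.Integer.Properties as ℤ
import Data.Nat.Coprimality as Coprime
open import Data.Rational using (mkℚ; _/_; 1ℚ; -_) renaming (_+_ to _+ℚ_; _*_ to _*ℚ_)
import Data.Rational.Properties as ℚ
open import Data.Maybe using (nothing)
open import Level using (0ℓ)
open import Tactic.RingSolver using () renaming (solve-∀ to solve-∀-in)
open import Tactic.RingSolver.Core.AlmostCommutativeRing using (AlmostCommutativeRing; fromCommutativeRing)
open import Data.Product using (_×_; _,_)
open import Relation.Binary.PropositionalEquality using (_≡_; refl; sym; trans; cong; cong₂; module ≡-Reasoning)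
open ≡-Reasoning

[k+1]*[n+1]C[k+1]≡[n+1]*nCk : ∀ n k → suc k * (suc n C suc k) ≡ suc n * (n C k)
[k+1]*[n+1]C[k+1]≡[n+1]*nCk n zero =
  trans (*-identityˡ _) (trans (nC1≡n (suc n)) (sym (*-identityʳ (suc n))))
[k+1]*[n+1]C[k+1]≡[n+1]*nCk zero (suc k) = begin
  suc (suc k) * (1 C suc (suc k)) ≡⟨ cong (suc (suc k) *_) (k>n⇒nCk≡0 {1} {suc (suc k)} (s≤s (s≤s z≤n))) ⟩
  suc (suc k) * 0                 ≡⟨ *-zeroʳ (suc (suc k)) ⟩
  0                               ≡⟨ cong (1 *_) (k>n⇒nCk≡0 {0} {suc k} (s≤s z≤n)) ⟨
  1 * (0 C suc k)                 ∎
[k+1]*[n+1]C[k+1]≡[n+1]*nCk (suc n) (suc k) = begin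
  suc (suc k) * (suc (suc n) C suc (suc k))
    ≡⟨ cong (suc (suc k) *_) (nCk+nC[k+1]≡[n+1]C[k+1] (suc n) (suc k)) ⟨
  suc (suc k) * (suc n C suc k + suc n C suc (suc k))
    ≡⟨ regroup (suc n C suc k) (suc n C suc (suc k)) k ⟩
  suc n C suc k + (suc k * (suc n C suc k) + suc (suc k) * (suc n C suc (suc k)))
    ≡⟨ cong₂ (λ a b → suc n C suc k + (a + b))
             ([k+1]*[n+1]C[k+1]≡[n+1]*nCk n k) ([k+1]*[n+1]C[k+1]≡[n+1]*nCk n (suc k)) ⟩
  suc n C suc k + (suc n * (n C k) + suc n * (n C suc k))
    ≡⟨ cong (suc n C suc k +_) (*-distribˡ-+ (suc n) (n C k) (n C suc k)) ⟨
  suc n C suc k + suc n * (n C k + n C suc k)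
    ≡⟨ cong (λ a → suc n C suc k + suc n * a) (nCk+nC[k+1]≡[n+1]C[k+1] n k) ⟩
  suc (suc n) * (suc n C suc k) ∎
  where
  regroup : ∀ a b k → suc (suc k) * (a + b) ≡ a + (suc k * a + suc (suc k) * b)
  regroup = solve-∀

[k+1]*[n+k]C[k+1]≡n*[n+k]Ck : ∀ n k → suc k * ((n + k) C suc k) ≡ n * ((n + k) C k)
[k+1]*[n+k]C[k+1]≡n*[n+k]Ck n k = +-cancelˡ-≡ (suc k * ((n + k) C k)) _ _ (begin
  suc k * ((n + k) C k) + suc k * ((n + k) C suc k)
    ≡⟨ *-distribˡ-+ (suc k) ((n + k) C k) ((n + k) C suc k) ⟨
  suc k * ((n + k) C k + (n + k) C suc k)
    ≡⟨ cong (suc k *_) (nCk+nC[k+1]≡[n+1]C[k+1] (n + k) k) ⟩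
  suc k * (suc (n + k) C suc k)
    ≡⟨ [k+1]*[n+1]C[k+1]≡[n+1]*nCk (n + k) k ⟩
  suc (n + k) * ((n + k) C k)
    ≡⟨ split n k ((n + k) C k) ⟩
  suc k * ((n + k) C k) + n * ((n + k) C k) ∎)
  where
  split : ∀ n k x → suc (n + k) * x ≡ suc k * x + n * x
  split = solve-∀

[n+2]*[n+1]Ck≡[n+1]*nCk+[k+1]*[n+1]Ck : ∀ n k →
  suc (suc n) * (suc n C k) ≡ suc n * (n C k) + suc k * (suc n C k)
[n+2]*[n+1]Ck≡[n+1]*nCk+[k+1]*[n+1]Ck n zero = base n
  where
  base : ∀ n → suc (suc n) * 1 ≡ suc n * 1 + 1 * 1
  base = solve-∀
[n+2]*[n+1]Ck≡[n+1]*nCk+[k+1]*[n+1]Ck n (suc j) = begin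
  suc (suc n) * (suc n C suc j)
    ≡⟨ cong (λ x → suc n C suc j + suc n * x) (nCk+nC[k+1]≡[n+1]C[k+1] n j) ⟨
  suc n C suc j + suc n * (n C j + n C suc j)
    ≡⟨ regroup (suc n C suc j) (n C j) (n C suc j) n ⟩
  suc n C suc j + suc n * (n C j) + suc n * (n C suc j)
    ≡⟨ cong (λ x → suc n C suc j + x + suc n * (n C suc j)) ([k+1]*[n+1]C[k+1]≡[n+1]*nCk n j) ⟨
  suc (suc j) * (suc n C suc j) + suc n * (n C suc j)
    ≡⟨ +-comm (suc (suc j) * (suc n C suc j)) _ ⟩
  suc n * (n C suc j) + suc (suc j) * (suc n C suc j) ∎
  where
  regroup : ∀ c a b n → c + suc n * (a + b) ≡ c + suc n * a + suc n * b
  regroup = solve-∀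

[m+1]C[j+1]*[m+j+1]Cj≡mCj*[m+j+1]C[j+1] : ∀ m j →
  (suc m C suc j) * ((m + suc j) C j) ≡ (m C j) * ((m + suc j) C suc j)
[m+1]C[j+1]*[m+j+1]Cj≡mCj*[m+j+1]C[j+1] m j rewrite +-suc m j = *-cancelˡ-≡ _ _ (suc j) (begin
  suc j * ((suc m C suc j) * (N C j))  ≡⟨ *-assoc (suc j) (suc m C suc j) (N C j) ⟨
  suc j * (suc m C suc j) * (N C j)    ≡⟨ cong (_* (N C j)) ([k+1]*[n+1]C[k+1]≡[n+1]*nCk m j) ⟩
  suc m * (m C j) * (N C j)            ≡⟨ *-assoc (suc m) (m C j) (N C j) ⟩
  suc m * ((m C j) * (N C j))          ≡⟨ x∙yz≈y∙xz (suc m) (m C j) (N C j) ⟩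
  (m C j) * (suc m * (N C j))          ≡⟨ cong ((m C j) *_) ([k+1]*[n+k]C[k+1]≡n*[n+k]Ck (suc m) j) ⟨
  (m C j) * (suc j * (N C suc j))      ≡⟨ x∙yz≈y∙xz (m C j) (suc j) (N C suc j) ⟩
  suc j * ((m C j) * (N C suc j))      ∎)
  where
  N = suc m + j

-- cP l k is the face number c_k of the paper, so that fP l k = (-1)^k cP l k.
cA cA⁺ cB cB⁺ cD : ℕ → ℕ → ℕ
cA l k  = (l C k) * ((l + k + 2) C (k + 1))
cA⁺ n k = (n C k) * ((n + k) C (k + 1))
cB l k  = (l C k) * ((l + k) C k)
cB⁺ l k = (l C k) * ((l + k ∸ 1) C k)
cD l k  = cB⁺ l k + dExtra l k

cA-recurrence₀ : ∀ l → (l + 1) * cA l 0 ≡ (l + 2) * cA⁺ (l + 1) 0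
cA-recurrence₀ l rewrite nC1≡n (l + 0 + 2) | nC1≡n (l + 1 + 0) = arith l
  where
  arith : ∀ l → (l + 1) * (1 * (l + 0 + 2)) ≡ (l + 2) * (1 * (l + 1 + 0))
  arith = solve-∀

cA-recurrence : ∀ l j → (l + 1) * (cA l (suc j) + cA l j) ≡ (l + 2) * cA⁺ (l + 1) (suc j)
cA-recurrence l j
  -- bring the indices into the form K = j + 1, N = (l + 1) + K, l + K + 2 = N + 1
  rewrite +-comm j 1 | +-comm (l + suc j) 2 | trans (+-comm (l + j) 2) (cong suc (sym (+-suc l j)))
        | +-comm l 1 | +-comm l 2 = begin
  suc l * ((l C K) * (suc N C suc K) + (l C j) * (N C K))
    ≡⟨ cong (λ x → suc l * ((l C K) * x + (l C j) * (N C K))) (nCk+nC[k+1]≡[n+1]C[k+1] N K) ⟨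
  suc l * ((l C K) * (N C K + N C suc K) + (l C j) * (N C K))
    ≡⟨ regroup (l C K) (l C j) (N C K) (N C suc K) l ⟩
  suc l * (N C K) * (l C j + l C K) + suc l * (l C K) * (N C suc K)
    ≡⟨ cong₂ (λ x y → x * y + suc l * (l C K) * (N C suc K))
             (sym ([k+1]*[n+k]C[k+1]≡n*[n+k]Ck (suc l) K)) (nCk+nC[k+1]≡[n+1]C[k+1] l j) ⟩
  suc K * (N C suc K) * (suc l C K) + suc l * (l C K) * (N C suc K)
    ≡⟨ collect (suc K) (N C suc K) (suc l C K) (suc l * (l C K)) ⟩
  (suc l * (l C K) + suc K * (suc l C K)) * (N C suc K)
    ≡⟨ cong (_* (N C suc K)) ([n+2]*[n+1]Ck≡[n+1]*nCk+[k+1]*[n+1]Ck l K) ⟨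
  suc (suc l) * (suc l C K) * (N C suc K)
    ≡⟨ *-assoc (suc (suc l)) (suc l C K) (N C suc K) ⟩
  suc (suc l) * ((suc l C K) * (N C suc K)) ∎
  where
  K = suc j
  N = suc l + K
  regroup : ∀ a b c d l → suc l * (a * (c + d) + b * c) ≡ suc l * c * (b + a) + suc l * a * d
  regroup = solve-∀
  collect : ∀ k x y z → k * x * y + z * x ≡ (z + k * y) * x
  collect = solve-∀

cB-sum : ∀ m k → cB (suc m) k + cB m k ≡ 2 * cB⁺ (suc m) k
cB-sum m zero    = refl
cB-sum m (suc j) = begin
  (suc m C K) * (suc N C K) + (m C K) * (N C K)
    ≡⟨ cong (λ x → (suc m C K) * x + (m C K) * (N C K)) (nCk+nC[k+1]≡[n+1]C[k+1] N j) ⟨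
  (suc m C K) * (N C j + N C K) + (m C K) * (N C K)
    ≡⟨ regroup (suc m C K) (m C K) (N C j) (N C K) ⟩
  (suc m C K) * (N C j) + (m C K) * (N C K) + (suc m C K) * (N C K)
    ≡⟨ cong (λ x → x + (m C K) * (N C K) + (suc m C K) * (N C K))
            ([m+1]C[j+1]*[m+j+1]Cj≡mCj*[m+j+1]C[j+1] m j) ⟩
  (m C j) * (N C K) + (m C K) * (N C K) + (suc m C K) * (N C K)
    ≡⟨ cong (_+ (suc m C K) * (N C K)) (*-distribʳ-+ (N C K) (m C j) (m C K)) ⟨
  (m C j + m C K) * (N C K) + (suc m C K) * (N C K)
    ≡⟨ cong (λ x → x * (N C K) + (suc m C K) * (N C K)) (nCk+nC[k+1]≡[n+1]C[k+1] m j) ⟩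
  (suc m C K) * (N C K) + (suc m C K) * (N C K)
    ≡⟨ cong ((suc m C K) * (N C K) +_) (+-identityʳ _) ⟨
  2 * ((suc m C K) * (N C K)) ∎
  where
  K = suc j
  N = m + K
  regroup : ∀ a b c d → a * (c + d) + b * d ≡ a * c + b * d + a * d
  regroup = solve-∀

cB⁺+[m+1]dExtra≡cB+[m+2]cB : ∀ m j →
  cB⁺ (2 + m) (suc j) + suc m * dExtra (2 + m) (suc j) ≡ cB (suc m) (suc j) + (2 + m) * cB (suc m) j
cB⁺+[m+1]dExtra≡cB+[m+2]cB m j = begin
  ((2 + m) C suc j) * M + suc m * dExtra (2 + m) (suc j)
    ≡⟨ cong (λ x → x * M + suc m * dExtra (2 + m) (suc j)) (nCk+nC[k+1]≡[n+1]C[k+1] (suc m) j) ⟨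
  (suc m C j + suc m C suc j) * M + suc m * dExtra (2 + m) (suc j)
    ≡⟨ regroup (suc m C j) (suc m C suc j) M (suc m * dExtra (2 + m) (suc j)) ⟩
  (suc m C suc j) * M + ((suc m C j) * M + suc m * dExtra (2 + m) (suc j))
    ≡⟨ cong ((suc m C suc j) * M +_) (absorb-dExtra m j) ⟩
  cB (suc m) (suc j) + (2 + m) * cB (suc m) j ∎
  where
  M = (suc m + suc j) C suc j
  regroup : ∀ a b m e → (a + b) * m + e ≡ b * m + (a * m + e)
  regroup = solve-∀
  absorb-dExtra : ∀ m j →
    (suc m C j) * ((suc m + suc j) C suc j) + suc m * dExtra (2 + m) (suc j) ≡ (2 + m) * cB (suc m) j
  absorb-dExtra m zero rewrite nC1≡n (suc m + 1) = base m
    where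
    base : ∀ m → 1 * (suc m + 1) + suc m * 0 ≡ suc (suc m) * (1 * 1)
    base = solve-∀
  absorb-dExtra m (suc i) rewrite +-suc m (suc i) = begin
    (suc m C suc i) * (suc N C I) + suc m * ((m C i) * (N C I))
      ≡⟨ cong ((suc m C suc i) * (suc N C I) +_) (*-assoc (suc m) (m C i) (N C I)) ⟨
    (suc m C suc i) * (suc N C I) + suc m * (m C i) * (N C I)
      ≡⟨ cong (λ x → (suc m C suc i) * (suc N C I) + x * (N C I)) ([k+1]*[n+1]C[k+1]≡[n+1]*nCk m i) ⟨
    (suc m C suc i) * (suc N C I) + suc i * (suc m C suc i) * (N C I)
      ≡⟨ factor (suc m C suc i) (suc N C I) (suc i) (N C I) ⟩
    (suc m C suc i) * (suc N C I + suc i * (N C I))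
      ≡⟨ cong ((suc m C suc i) *_) bracket ⟩
    (suc m C suc i) * (suc (suc m) * (N C suc i))
      ≡⟨ x∙yz≈y∙xz (suc m C suc i) (suc (suc m)) (N C suc i) ⟩
    suc (suc m) * ((suc m C suc i) * (N C suc i)) ∎
    where
    I = suc (suc i)
    N = suc m + suc i
    factor : ∀ a b k c → a * b + k * a * c ≡ a * (b + k * c)
    factor = solve-∀
    bracket : suc N C I + suc i * (N C I) ≡ suc (suc m) * (N C suc i)
    bracket = begin
      suc N C I + suc i * (N C I)
        ≡⟨ cong (_+ suc i * (N C I)) (nCk+nC[k+1]≡[n+1]C[k+1] N (suc i)) ⟨
      N C suc i + N C I + suc i * (N C I)
        ≡⟨ +-assoc (N C suc i) (N C I) (suc i * (N C I)) ⟩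
      N C suc i + I * (N C I)
        ≡⟨ cong (N C suc i +_) ([k+1]*[n+k]C[k+1]≡n*[n+k]Ck (suc m) (suc i)) ⟩
      suc (suc m) * (N C suc i) ∎

cD-decomposition : ∀ m j →
  2 * suc m * cD (2 + m) (suc j) ≡ m * cB (2 + m) (suc j) + (2 + m) * (cB (suc m) (suc j) + 2 * cB (suc m) j)
cD-decomposition m j = begin
  2 * suc m * (cB⁺ (2 + m) (suc j) + dExtra (2 + m) (suc j))
    ≡⟨ expand m (cB⁺ (2 + m) (suc j)) (dExtra (2 + m) (suc j)) ⟩
  m * (2 * cB⁺ (2 + m) (suc j)) + 2 * (cB⁺ (2 + m) (suc j) + suc m * dExtra (2 + m) (suc j))
    ≡⟨ cong₂ (λ x y → m * x + 2 * y) (cB-sum (suc m) (suc j)) (sym (cB⁺+[m+1]dExtra≡cB+[m+2]cB m j)) ⟨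
  m * (cB (2 + m) (suc j) + cB (suc m) (suc j)) + 2 * (cB (suc m) (suc j) + (2 + m) * cB (suc m) j)
    ≡⟨ collect m (cB (2 + m) (suc j)) (cB (suc m) (suc j)) (cB (suc m) j) ⟩
  m * cB (2 + m) (suc j) + (2 + m) * (cB (suc m) (suc j) + 2 * cB (suc m) j) ∎
  where
  expand : ∀ m p e → 2 * suc m * (p + e) ≡ m * (2 * p) + 2 * (p + suc m * e)
  expand = solve-∀
  collect : ∀ m x y z → m * (x + y) + 2 * (y + (2 + m) * z) ≡ m * x + (2 + m) * (y + 2 * z)
  collect = solve-∀

ℚ-ring : AlmostCommutativeRing 0ℓ 0ℓ
ℚ-ring = fromCommutativeRing ℚ.+-*-commutativeRing (λ _ → nothing)

nat≡mkℚ : ∀ n → nat n ≡ mkℚ (ℤ.+ n) 0 (Coprime.sym (Coprime.1-coprimeTo n))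
nat≡mkℚ n = ℚ.↥p/↧p≡p (mkℚ (ℤ.+ n) 0 _)

nat-+ : ∀ a b → nat (a + b) ≡ nat a +ℚ nat b
nat-+ a b = sym (trans (cong₂ _+ℚ_ (nat≡mkℚ a) (nat≡mkℚ b))
  (cong (_/ 1) (cong₂ ℤ._+_ (ℤ.*-identityʳ (ℤ.+ a)) (ℤ.*-identityʳ (ℤ.+ b)))))

nat-* : ∀ a b → nat (a * b) ≡ nat a *ℚ nat b
nat-* a b = sym (trans (cong₂ _*ℚ_ (nat≡mkℚ a) (nat≡mkℚ b)) (cong (_/ 1) (sym (ℤ.pos-* a b))))

frac1≡mkℚ : ∀ n → frac 1 (suc n) ≡ mkℚ (ℤ.+ 1) n (Coprime.1-coprimeTo (suc n))
frac1≡mkℚ n = ℚ.↥p/↧p≡p (mkℚ (ℤ.+ 1) n _)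

frac-inverseˡ : ∀ n .{{_ : NonZero n}} → frac 1 n *ℚ nat n ≡ 1ℚ
frac-inverseˡ (suc n) = trans (cong₂ _*ℚ_ (frac1≡mkℚ n) (nat≡mkℚ (suc n))) (ℚ.*-inverseˡ (mkℚ (ℤ.+ suc n) 0 (Coprime.sym (Coprime.1-coprimeTo (suc n)))))

frac≡nat*frac1 : ∀ a n → frac a n ≡ nat a *ℚ frac 1 n
frac≡nat*frac1 a zero    = sym (ℚ.*-zeroʳ (nat a))
frac≡nat*frac1 a (suc n) = sym (trans (cong₂ _*ℚ_ (nat≡mkℚ a) (frac1≡mkℚ n))
  (ℚ./-cong (ℤ.*-identityʳ (ℤ.+ a)) (*-identityˡ (suc n))))

nat≡frac1*nat : ∀ n .{{_ : NonZero n}} {a b} → n * a ≡ b → nat a ≡ frac 1 n *ℚ nat b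
nat≡frac1*nat n {a} {b} eq = begin
  nat a                        ≡⟨ ℚ.*-identityˡ (nat a) ⟨
  1ℚ *ℚ nat a                  ≡⟨ cong (_*ℚ nat a) (frac-inverseˡ n) ⟨
  frac 1 n *ℚ nat n *ℚ nat a   ≡⟨ ℚ.*-assoc (frac 1 n) (nat n) (nat a) ⟩
  frac 1 n *ℚ (nat n *ℚ nat a) ≡⟨ cong (frac 1 n *ℚ_) (nat-* n a) ⟨
  frac 1 n *ℚ nat (n * a)      ≡⟨ cong (λ x → frac 1 n *ℚ nat x) eq ⟩
  frac 1 n *ℚ nat b            ∎

frac-cancel : ∀ m n .{{_ : NonZero m}} .{{_ : NonZero n}} {a b} →
  n * a ≡ m * b → frac 1 m *ℚ nat a ≡ frac 1 n *ℚ nat b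
frac-cancel m n {a} {b} eq = begin
  frac 1 m *ℚ nat a
    ≡⟨ cong (frac 1 m *ℚ_) (trans (nat≡frac1*nat n eq) (cong (frac 1 n *ℚ_) (nat-* m b))) ⟩
  frac 1 m *ℚ (frac 1 n *ℚ (nat m *ℚ nat b))
    ≡⟨ regroup (frac 1 m) (frac 1 n) (nat m) (nat b) ⟩
  frac 1 n *ℚ ((frac 1 m *ℚ nat m) *ℚ nat b)
    ≡⟨ cong (λ x → frac 1 n *ℚ (x *ℚ nat b)) (frac-inverseˡ m) ⟩
  frac 1 n *ℚ (1ℚ *ℚ nat b)
    ≡⟨ cong (frac 1 n *ℚ_) (ℚ.*-identityˡ (nat b)) ⟩
  frac 1 n *ℚ nat b ∎
  where
  regroup : ∀ p q r x → p *ℚ (q *ℚ (r *ℚ x)) ≡ q *ℚ ((p *ℚ r) *ℚ x)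
  regroup = solve-∀-in ℚ-ring

nat≡frac-combination : ∀ n .{{_ : NonZero n}} a b {x y z} → n * x ≡ a * y + b * z →
  nat x ≡ frac a n *ℚ nat y +ℚ frac b n *ℚ nat z
nat≡frac-combination n a b {x} {y} {z} eq = begin
  nat x
    ≡⟨ nat≡frac1*nat n eq ⟩
  e *ℚ nat (a * y + b * z)
    ≡⟨ cong (e *ℚ_) (trans (nat-+ (a * y) (b * z)) (cong₂ _+ℚ_ (nat-* a y) (nat-* b z))) ⟩
  e *ℚ (nat a *ℚ nat y +ℚ nat b *ℚ nat z)
    ≡⟨ distrib e (nat a) (nat y) (nat b) (nat z) ⟩
  nat a *ℚ e *ℚ nat y +ℚ nat b *ℚ e *ℚ nat z
    ≡⟨ cong₂ (λ p q → p *ℚ nat y +ℚ q *ℚ nat z) (frac≡nat*frac1 a n) (frac≡nat*frac1 b n) ⟨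
  frac a n *ℚ nat y +ℚ frac b n *ℚ nat z ∎
  where
  e = frac 1 n
  distrib : ∀ e a y b z → e *ℚ (a *ℚ y +ℚ b *ℚ z) ≡ a *ℚ e *ℚ y +ℚ b *ℚ e *ℚ z
  distrib = solve-∀-in ℚ-ring

[1-t]fAₗ≈fA⁺ₗ₊₁ : ∀ l → 1 ≤ l → mulLin 1ℚ (- 1ℚ) (fA l) ≈ₚ fA⁺ (l + 1)
[1-t]fAₗ≈fA⁺ₗ₊₁ (suc l) (s≤s _) zero =
  cong (1ℚ *ℚ_) (trans (ℚ.*-identityˡ _) (frac-cancel (suc l + 2) (suc l + 1) (cA-recurrence₀ (suc l))))
[1-t]fAₗ≈fA⁺ₗ₊₁ (suc l) (s≤s _) (suc j) = begin
  1ℚ *ℚ (- s *ℚ (c *ℚ nat (cA (suc l) (suc j)))) +ℚ (- 1ℚ) *ℚ (s *ℚ (c *ℚ nat (cA (suc l) j)))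
    ≡⟨ collect s c (nat (cA (suc l) (suc j))) (nat (cA (suc l) j)) ⟩
  - s *ℚ (c *ℚ (nat (cA (suc l) (suc j)) +ℚ nat (cA (suc l) j)))
    ≡⟨ cong (λ x → - s *ℚ (c *ℚ x)) (nat-+ (cA (suc l) (suc j)) (cA (suc l) j)) ⟨
  - s *ℚ (c *ℚ nat (cA (suc l) (suc j) + cA (suc l) j))
    ≡⟨ cong (- s *ℚ_) (frac-cancel (suc l + 2) (suc l + 1) (cA-recurrence (suc l) j)) ⟩
  - s *ℚ (frac 1 (suc l + 1) *ℚ nat (cA⁺ (suc l + 1) (suc j))) ∎
  where
  s = sgn j
  c = frac 1 (suc l + 2)
  collect : ∀ s c a b → 1ℚ *ℚ (- s *ℚ (c *ℚ a)) +ℚ (- 1ℚ) *ℚ (s *ℚ (c *ℚ b)) ≡ - s *ℚ (c *ℚ (a +ℚ b))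
  collect = solve-∀-in ℚ-ring

fBₗ+fBₗ₋₁≈2fB⁺ₗ : ∀ l → 2 ≤ l → (fB l ⊕ fB (l ∸ 1)) ≈ₚ ((1ℚ +ℚ 1ℚ) ⊙ fB⁺ l)
fBₗ+fBₗ₋₁≈2fB⁺ₗ (suc m) (s≤s _) k = begin
  s *ℚ nat (cB (suc m) k) +ℚ s *ℚ nat (cB m k)
    ≡⟨ ℚ.*-distribˡ-+ s (nat (cB (suc m) k)) (nat (cB m k)) ⟨
  s *ℚ (nat (cB (suc m) k) +ℚ nat (cB m k))
    ≡⟨ cong (s *ℚ_) (nat-+ (cB (suc m) k) (cB m k)) ⟨
  s *ℚ nat (cB (suc m) k + cB m k)
    ≡⟨ cong (λ x → s *ℚ nat x) (cB-sum m k) ⟩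
  s *ℚ nat (2 * cB⁺ (suc m) k)
    ≡⟨ cong (s *ℚ_) (nat-* 2 (cB⁺ (suc m) k)) ⟩
  s *ℚ (nat 2 *ℚ nat (cB⁺ (suc m) k))
    ≡⟨ swap s (nat (cB⁺ (suc m) k)) ⟩
  (1ℚ +ℚ 1ℚ) *ℚ (s *ℚ nat (cB⁺ (suc m) k)) ∎
  where
  s = sgn k
  swap : ∀ s z → s *ℚ ((1ℚ +ℚ 1ℚ) *ℚ z) ≡ (1ℚ +ℚ 1ℚ) *ℚ (s *ℚ z)
  swap = solve-∀-in ℚ-ring

fDₗ≈fB-combination : ∀ l → 4 ≤ l →
  fD l ≈ₚ ((frac (l ∸ 2) (2 * (l ∸ 1)) ⊙ fB l) ⊕ (frac l (2 * (l ∸ 1)) ⊙ mulLin 1ℚ (- (1ℚ +ℚ 1ℚ)) (fB (l ∸ 1))))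
fDₗ≈fB-combination (suc (suc m)) (s≤s (s≤s _)) zero = begin
  1ℚ *ℚ nat 1                                  ≡⟨ ℚ.*-identityˡ (nat 1) ⟩
  nat 1                                        ≡⟨ nat≡frac-combination (2 * suc m) m (2 + m) {1} {1} {1} (base m) ⟩
  p *ℚ nat 1 +ℚ q *ℚ nat 1                     ≡⟨ pad p q (nat 1) ⟩
  p *ℚ (1ℚ *ℚ nat 1) +ℚ q *ℚ (1ℚ *ℚ (1ℚ *ℚ nat 1)) ∎
  where
  p = frac m (2 * suc m)
  q = frac (2 + m) (2 * suc m)
  base : ∀ m → 2 * suc m * 1 ≡ m * 1 + (2 + m) * 1
  base = solve-∀
  pad : ∀ p q x → p *ℚ x +ℚ q *ℚ x ≡ p *ℚ (1ℚ *ℚ x) +ℚ q *ℚ (1ℚ *ℚ (1ℚ *ℚ x))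
  pad = solve-∀-in ℚ-ring
fDₗ≈fB-combination (suc (suc m)) (s≤s (s≤s _)) (suc j) = begin
  - s *ℚ nat (cD (2 + m) (suc j))
    ≡⟨ cong (- s *ℚ_) (nat≡frac-combination (2 * suc m) m (2 + m) {z = z₁ + 2 * z₀} (cD-decomposition m j)) ⟩
  - s *ℚ (p *ℚ nat y +ℚ q *ℚ nat (z₁ + 2 * z₀))
    ≡⟨ cong (λ x → - s *ℚ (p *ℚ nat y +ℚ q *ℚ x)) (trans (nat-+ z₁ (2 * z₀)) (cong (nat z₁ +ℚ_) (nat-* 2 z₀))) ⟩
  - s *ℚ (p *ℚ nat y +ℚ q *ℚ (nat z₁ +ℚ (1ℚ +ℚ 1ℚ) *ℚ nat z₀))
    ≡⟨ distrib s p q (nat y) (nat z₁) (nat z₀) ⟩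
  p *ℚ (- s *ℚ nat y) +ℚ q *ℚ (1ℚ *ℚ (- s *ℚ nat z₁) +ℚ (- (1ℚ +ℚ 1ℚ)) *ℚ (s *ℚ nat z₀)) ∎
  where
  s = sgn j
  p = frac m (2 * suc m)
  q = frac (2 + m) (2 * suc m)
  y = cB (2 + m) (suc j)
  z₁ = cB (suc m) (suc j)
  z₀ = cB (suc m) j
  distrib : ∀ s p q y z₁ z₀ →
    - s *ℚ (p *ℚ y +ℚ q *ℚ (z₁ +ℚ (1ℚ +ℚ 1ℚ) *ℚ z₀))
      ≡ p *ℚ (- s *ℚ y) +ℚ q *ℚ (1ℚ *ℚ (- s *ℚ z₁) +ℚ (- (1ℚ +ℚ 1ℚ)) *ℚ (s *ℚ z₀))
  distrib = solve-∀-in ℚ-ring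

proposition2p1 :
  (∀ (l : ℕ) → 1 ≤ l → mulLin 1ℚ (- 1ℚ) (fA l) ≈ₚ fA⁺ (l + 1))
  × (∀ (l : ℕ) → 2 ≤ l → (fB l ⊕ fB (l ∸ 1)) ≈ₚ ((1ℚ +ℚ 1ℚ) ⊙ fB⁺ l))
  × (∀ (l : ℕ) → 4 ≤ l →
      fD l ≈ₚ ((frac (l ∸ 2) (2 * (l ∸ 1)) ⊙ fB l)
               ⊕ (frac l (2 * (l ∸ 1)) ⊙ mulLin 1ℚ (- (1ℚ +ℚ 1ℚ)) (fB (l ∸ 1)))))
proposition2p1 = [1-t]fAₗ≈fA⁺ₗ₊₁ , fBₗ+fBₗ₋₁≈2fB⁺ₗ , fDₗ≈fB-combination
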